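{- Let $T$ be a cubic tree with $|V(T)| \ge 4$, let $(X,Y)$ be a split of $V_1(T)$, and let $\epsilon \in \{1,-1\}$. Then there exists a split $(X^*,Y^*)$ of $T$ such that: (1) $X \subseteq X^*$ and $Y \subseteq Y^*$; (2) $\mathrm{disc}_T(X^*,Y^*) \in \{0, \epsilon, 2\epsilon\}$; (3) the graph $T - E(X^*,Y^*)$ has at most one vertex of degree greater than one.
   Context: Graphs are finite and simple. A tree is cubic if each of its vertices has degree $1$ or $3$. For a graph $G$, $V_1(G)$ denotes the set of vertices of degree $1$ in $G$. A split of a set $S$ is a pair $(A,B)$ of disjoint sets with $A \sqcup B = S$; a split of a graph is a split of its vertex set. For a split $(X,Y)$ of a graph $G$, $E(X,Y)$ is the set of edges with one end in $X$ and one in $Y$, and the discrepancy is $\mathrm{disc}_G(X,Y) = e(G[X]) - e(G[Y])$, where $e(\cdot)$ denotes the number of edges. -}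

module Defs where

open import Data.Nat using (ℕ; zero; suc; _+_; _<ᵇ_; _>_; _≥_)
open import Data.Bool using (Bool; true; false; if_then_else_; _∧_; not)
open import Data.Bool.Properties using (∧-comm)
open import Data.Fin using (Fin; toℕ) renaming (zero to fzero; suc to fsuc)
open import Data.List using (List; []; _∷_; _++_)
open import Data.List.Relation.Unary.Unique.Propositional using (Unique)
open import Data.Integer using (ℤ; +_; _-_)
open import Data.Product using (Σ; ∃; _×_; _,_)
open import Data.Sum using (_⊎_)
open import Data.Unit using (⊤)
open import Data.Empty using (⊥)
open import Relation.Nullary using (¬_)
open import Relation.Binary.PropositionalEquality using (_≡_; refl; cong₂)

record Graph (n : ℕ) : Set where
  field
    adj    : Fin n → Fin n → Bool
    sym    : ∀ u v → adj u v ≡ adj v u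
    irrefl : ∀ v → adj v v ≡ false
open Graph public

count : ∀ {n} → (Fin n → Bool) → ℕ
count {zero}  f = 0
count {suc n} f = (if f fzero then 1 else 0) + count (λ i → f (fsuc i))

degree : ∀ {n} → Graph n → Fin n → ℕ
degree G v = count (adj G v)

data Walk {n} (G : Graph n) : Fin n → Fin n → Set where
  here : ∀ {v} → Walk G v v
  step : ∀ {u w v} → adj G u w ≡ true → Walk G w v → Walk G u v

Connected : ∀ {n} → Graph n → Set
Connected G = ∀ u v → Walk G u v

AdjChain : ∀ {n} → Graph n → List (Fin n) → Set
AdjChain G []            = ⊤
AdjChain G (x ∷ [])      = ⊤
AdjChain G (x ∷ y ∷ r)   = (adj G x y ≡ true) × AdjChain G (y ∷ r)

HasCycle : ∀ {n} → Graph n → Set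
HasCycle {n} G = Σ (Fin n) λ x → Σ (Fin n) λ y → Σ (Fin n) λ z → Σ (List (Fin n)) λ rest →
  Unique (x ∷ y ∷ z ∷ rest) × AdjChain G (x ∷ y ∷ z ∷ rest ++ x ∷ [])

IsTree : ∀ {n} → Graph n → Set
IsTree G = Connected G × ¬ HasCycle G

IsCubicTree : ∀ {n} → Graph n → Set
IsCubicTree {n} G = IsTree G × (∀ (v : Fin n) → (degree G v ≡ 1) ⊎ (degree G v ≡ 3))

IsLeaf : ∀ {n} → Graph n → Fin n → Set
IsLeaf G v = degree G v ≡ 1

sumF : ∀ {n} → (Fin n → ℕ) → ℕ
sumF {zero}  f = 0
sumF {suc n} f = f fzero + sumF (λ i → f (fsuc i))

edgesIn : ∀ {n} → Graph n → (Fin n → Bool) → ℕ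
edgesIn G S = sumF (λ u → count (λ v → (toℕ u <ᵇ toℕ v) ∧ adj G u v ∧ S u ∧ S v))

-- A split (X*, Y*) of a graph on Fin n is encoded by s : Fin n → Bool,
-- X* = {v | s v ≡ true}, Y* = {v | s v ≡ false}.
sideX sideY : ∀ {n} → (Fin n → Bool) → (Fin n → Bool)
sideX s v = s v
sideY s v = not (s v)

disc : ∀ {n} → Graph n → (Fin n → Bool) → ℤ
disc G s = + edgesIn G (sideX s) - + edgesIn G (sideY s)

_==_ : Bool → Bool → Bool
true  == b = b
false == b = not b

==-sym : ∀ a b → (a == b) ≡ (b == a)
==-sym true true = refl
==-sym true false = refl
==-sym false true = refl
==-sym false false = refl

deleteCut : ∀ {n} → Graph n → (Fin n → Bool) → Graph n
deleteCut G s = record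
  { adj    = λ u v → adj G u v ∧ (s u == s v)
  ; sym    = λ u v → cong₂ _∧_ (Graph.sym G u v) (==-sym (s u) (s v))
  ; irrefl = λ v → cong₂ _∧_ (irrefl G v) refl
  }

IsSplitOfLeaves : ∀ {n} → Graph n → (X Y : Fin n → Bool) → Set
IsSplitOfLeaves {n} G X Y =
  (∀ (v : Fin n) → ¬ (X v ≡ true × Y v ≡ true)) ×
  (∀ (v : Fin n) → (X v ≡ true ⊎ Y v ≡ true) → IsLeaf G v) ×
  (∀ (v : Fin n) → IsLeaf G v → (X v ≡ true ⊎ Y v ≡ true))

-- Prune T from its leaves.  A cubic tree with an internal vertex has a cherry, an internal vertex v
-- with two leaf neighbours l₁ and l₂ (otherwise the internal vertices would contain a cycle), and
-- deleting l₁ and l₂ leaves a smaller cubic tree in which v is a leaf standing for the subtree pruned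
-- into it.  A pruned subtree is summarised by a family of profiles its colourings can realise (root
-- colour, same-coloured children of the root, bad vertices below the root, signed degree sum), where
-- a vertex is bad if it has two same-coloured neighbours, i.e. degree > 1 in T − E(X*, Y*).  A
-- finite list of families, checked by evaluation, is closed under joining two subtrees at a new root,
-- and any two of them meeting across the last remaining edge admit a colouring with at most one bad
-- vertex and signed degree sum 0, 2ε or 4ε.  Unwinding the pruning extends that colouring to T, and
-- by the handshake lemma the signed degree sum of T is twice the discrepancy.

module Submission where

open import Defs renaming (sym to adj-sym)
open import Algebra.Bundles using (CommutativeMonoid)
import Algebra.Properties.CommutativeMonoid.Sum as MonoidSum
import Algebra.Properties.CommutativeSemigroup as CommutativeSemigroupProperties
open import Data.Bool using (Bool; true; false; if_then_else_; _∧_; not; T)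
open import Data.Bool.Properties using (∧-comm; ∧-zeroʳ)
import Data.Bool.Properties as Boolₚ
open import Data.Fin using (Fin; toℕ; _≟_) renaming (zero to fzero; suc to fsuc)
open import Data.Fin.Properties using (toℕ-injective)
import Data.Fin.Properties as Finₚ
open import Data.List using (List; []; _∷_; _++_)
open import Data.List.Membership.Propositional using (_∈_; _∉_; find)
open import Data.List.Membership.Propositional.Properties using (∈-∃++; ∈-++⁺ˡ; ∈-++⁺ʳ)
open import Data.List.Relation.Unary.Any using (Any; here; there; any?)
open import Data.List.Relation.Unary.All using (All; _∷_; []; all?)
import Data.List.Relation.Unary.All as All
import Data.List.Relation.Unary.All.Properties as Allₚ
open import Data.List.Relation.Unary.AllPairs using (_∷_; [])
open import Data.List.Relation.Unary.Unique.Propositional using (Unique)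
open import Data.Unit using (tt)
open import Data.Nat using (ℕ; zero; suc; _+_; _≤_; _<_; _>_; _≥_; _≤ᵇ_; _<ᵇ_; _≡ᵇ_; z≤n; s≤s)
import Data.Nat.Properties as ℕₚ
open import Data.Integer using (ℤ; +_; -_; _*_)
import Data.Integer as ℤ
import Data.Integer.Properties as ℤₚ
open import Data.Integer.Tactic.RingSolver using (solve-∀)
open import Data.Product using (Σ; ∃; ∃₂; _×_; _,_; proj₁; proj₂; map₂)
open import Data.Sum using (_⊎_; inj₁; inj₂)
import Data.Sum as Sum
open import Data.Vec.Functional using (updateAt)
open import Data.Vec.Functional.Properties using (updateAt-updates; updateAt-minimal)
open import Function using (_∘_)
open import Relation.Nullary using (¬_; Dec; yes; no; does; ofʸ; ofⁿ; _×-dec_; _⊎-dec_)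
open import Relation.Nullary.Decidable using (from-yes)
open import Relation.Nullary.Negation using (contradiction)
open import Relation.Binary.PropositionalEquality
  using (_≡_; _≢_; refl; sym; trans; cong; cong₂; subst; subst₂; _≗_; module ≡-Reasoning)

oneIf : Bool → ℕ
oneIf b = if b then 1 else 0

module FiniteSums {c ℓ} (M : CommutativeMonoid c ℓ) where
  open CommutativeMonoid M renaming
    ( _∙_ to _+ᴹ_; ε to 0#; ∙-congˡ to +-congˡ; ∙-congʳ to +-congʳ; ∙-cong to +-cong
    ; refl to ≈-refl; sym to ≈-sym; trans to ≈-trans)
  open MonoidSum M public using (sum; ∑-distrib-+; ∑-comm) renaming (sum-cong-≋ to sum-cong)
  open CommutativeSemigroupProperties commutativeSemigroup using (x∙yz≈y∙xz)
  open import Relation.Binary.Reasoning.Setoid setoid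

  infixl 6 _without_

  _without_ : ∀ {n} → (Fin n → Carrier) → Fin n → Fin n → Carrier
  (f without a) i = if does (i ≟ a) then 0# else f i

  without-≢ : ∀ {n} (f : Fin n → Carrier) {a i : Fin n} → i ≢ a → (f without a) i ≡ f i
  without-≢ f {a} {i} i≢a with i ≟ a
  ... | yes i≡a = contradiction i≡a i≢a
  ... | no _ = refl

  sum-without : ∀ {n} (f : Fin n → Carrier) a → sum f ≈ f a +ᴹ sum (f without a)
  sum-without f fzero = +-congˡ (≈-sym (identityˡ _))
  sum-without f (fsuc a) = begin
    f fzero +ᴹ sum (f ∘ fsuc)                                ≈⟨ +-congˡ (sum-without (f ∘ fsuc) a) ⟩
    f fzero +ᴹ (f (fsuc a) +ᴹ sum ((f ∘ fsuc) without a))    ≈⟨ x∙yz≈y∙xz _ _ _ ⟩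
    f (fsuc a) +ᴹ (f fzero +ᴹ sum ((f ∘ fsuc) without a))    ∎

  sum-zero : ∀ {n} {f : Fin n → Carrier} → (∀ i → f i ≈ 0#) → sum f ≈ 0#
  sum-zero {zero} f≈0 = ≈-refl
  sum-zero {suc n} f≈0 = ≈-trans (+-cong (f≈0 fzero) (sum-zero (f≈0 ∘ fsuc))) (identityˡ 0#)

  sum-pair : ∀ {n} {f : Fin n → Carrier} {a b : Fin n} → a ≢ b →
    (∀ i → i ≢ a → i ≢ b → f i ≈ 0#) → sum f ≈ f a +ᴹ f b
  sum-pair {f = f} {a} {b} a≢b f≈0 = begin
    sum f                                              ≈⟨ sum-without f a ⟩
    f a +ᴹ sum (f without a)                           ≈⟨ +-congˡ (sum-without (f without a) b) ⟩
    f a +ᴹ ((f without a) b +ᴹ sum (f without a without b))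
      ≈⟨ +-congˡ (+-cong (reflexive (without-≢ f (a≢b ∘ sym))) (sum-zero rest≈0)) ⟩
    f a +ᴹ (f b +ᴹ 0#)                                 ≈⟨ +-congˡ (identityʳ (f b)) ⟩
    f a +ᴹ f b                                         ∎
    where
    rest≈0 : ∀ i → (f without a without b) i ≈ 0#
    rest≈0 i with i ≟ b | i ≟ a
    ... | yes _ | _ = ≈-refl
    ... | no _ | yes _ = ≈-refl
    ... | no i≢b | no i≢a = f≈0 i i≢a i≢b

  sum-split₃ : ∀ {n} (f : Fin n → Carrier) {a b c : Fin n} → a ≢ b → a ≢ c → b ≢ c →
    sum f ≈ (f a +ᴹ (f b +ᴹ f c)) +ᴹ sum (f without a without b without c)
  sum-split₃ f {a} {b} {c} a≢b a≢c b≢c = begin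
    sum f                                                   ≈⟨ sum-without f a ⟩
    f a +ᴹ sum f∖a                                          ≈⟨ +-congˡ (sum-without f∖a b) ⟩
    f a +ᴹ (f∖a b +ᴹ sum f∖ab)                              ≈⟨ +-congˡ (+-congˡ (sum-without f∖ab c)) ⟩
    f a +ᴹ (f∖a b +ᴹ (f∖ab c +ᴹ sum (f∖ab without c)))
      ≈⟨ +-congˡ (+-cong (reflexive fb) (+-congʳ (reflexive fc))) ⟩
    f a +ᴹ (f b +ᴹ (f c +ᴹ sum (f∖ab without c)))           ≈⟨ +-congˡ (≈-sym (assoc _ _ _)) ⟩
    f a +ᴹ ((f b +ᴹ f c) +ᴹ sum (f∖ab without c))           ≈⟨ ≈-sym (assoc _ _ _) ⟩
    (f a +ᴹ (f b +ᴹ f c)) +ᴹ sum (f∖ab without c)           ∎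
    where
    f∖a = f without a
    f∖ab = f∖a without b
    fb : f∖a b ≡ f b
    fb = without-≢ f (a≢b ∘ sym)
    fc : f∖ab c ≡ f c
    fc = trans (without-≢ f∖a (b≢c ∘ sym)) (without-≢ f (a≢c ∘ sym))

  sum-local₃ : ∀ {n} (f g : Fin n → Carrier) {a b c : Fin n} → a ≢ b → a ≢ c → b ≢ c →
    (∀ i → i ≢ a → i ≢ b → i ≢ c → f i ≈ g i) →
    ∃ λ S → sum f ≈ (f a +ᴹ (f b +ᴹ f c)) +ᴹ S × sum g ≈ (g a +ᴹ (g b +ᴹ g c)) +ᴹ S
  sum-local₃ f g {a} {b} {c} a≢b a≢c b≢c f≈g =
    sum (g without a without b without c) ,
    ≈-trans (sum-split₃ f a≢b a≢c b≢c) (+-congˡ (sum-cong rest)) ,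
    sum-split₃ g a≢b a≢c b≢c
    where
    rest : ∀ i → (f without a without b without c) i ≈ (g without a without b without c) i
    rest i with i ≟ c | i ≟ b | i ≟ a
    ... | yes _ | _ | _ = ≈-refl
    ... | no _ | yes _ | _ = ≈-refl
    ... | no _ | no _ | yes _ = ≈-refl
    ... | no i≢c | no i≢b | no i≢a = f≈g i i≢a i≢b i≢c

module ℕΣ = FiniteSums ℕₚ.+-0-commutativeMonoid
module ℤΣ = FiniteSums ℤₚ.+-0-commutativeMonoid
open ℕΣ using (sum)

sum-point≤ : ∀ {n} (f : Fin n → ℕ) a → f a ≤ sum f
sum-point≤ f a = subst (f a ≤_) (sym (ℕΣ.sum-without f a)) (ℕₚ.m≤m+n (f a) _)

sum-pair≤ : ∀ {n} (f : Fin n → ℕ) {a b} → a ≢ b → f a + f b ≤ sum f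
sum-pair≤ f {a} {b} a≢b = begin
  f a + f b                          ≡⟨ cong (_+_ (f a)) (ℕΣ.without-≢ f (a≢b ∘ sym)) ⟨
  f a + (f ℕΣ.without a) b           ≤⟨ ℕₚ.+-monoʳ-≤ (f a) (sum-point≤ (f ℕΣ.without a) b) ⟩
  f a + sum (f ℕΣ.without a)         ≡⟨ ℕΣ.sum-without f a ⟨
  sum f                              ∎
  where open ℕₚ.≤-Reasoning

sumF≡sum : ∀ {n} (f : Fin n → ℕ) → sumF f ≡ sum f
sumF≡sum {zero} f = refl
sumF≡sum {suc n} f = cong (_+_ (f fzero)) (sumF≡sum (f ∘ fsuc))

ℤsum-pos : ∀ {n} (f : Fin n → ℕ) → ℤΣ.sum (+_ ∘ f) ≡ + sum f
ℤsum-pos {zero} f = refl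
ℤsum-pos {suc n} f = trans (cong (ℤ._+_ (+ f fzero)) (ℤsum-pos (f ∘ fsuc))) (sym (ℤₚ.pos-+ (f fzero) _))

ℤsum-neg : ∀ {n} (h : Fin n → ℤ) → ℤΣ.sum (-_ ∘ h) ≡ - ℤΣ.sum h
ℤsum-neg {zero} h = refl
ℤsum-neg {suc n} h = trans (cong (ℤ._+_ (- h fzero)) (ℤsum-neg (h ∘ fsuc))) (sym (ℤₚ.neg-distrib-+ (h fzero) _))

true-or-false : ∀ b → b ≡ true ⊎ b ≡ false
true-or-false true = inj₁ refl
true-or-false false = inj₂ refl

∧-true : ∀ {a b} → a ∧ b ≡ true → a ≡ true × b ≡ true
∧-true {true} {true} _ = refl , refl

∧-intro : ∀ {a b} → a ≡ true → b ≡ true → a ∧ b ≡ true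
∧-intro refl refl = refl

∧-swapʳ : ∀ a b c → (a ∧ b) ∧ c ≡ (a ∧ c) ∧ b
∧-swapʳ true b c = ∧-comm b c
∧-swapʳ false b c = refl

≡ᵇ-true : ∀ {m k} → (m ≡ᵇ k) ≡ true → m ≡ k
≡ᵇ-true {m} {k} eq = ℕₚ.≡ᵇ⇒≡ m k (subst T (sym eq) tt)

count≡sum : ∀ {n} (f : Fin n → Bool) → count f ≡ sum (oneIf ∘ f)
count≡sum {zero} f = refl
count≡sum {suc n} f = cong (_+_ (oneIf (f fzero))) (count≡sum (f ∘ fsuc))

count-cong : ∀ {n} {f g : Fin n → Bool} → f ≗ g → count f ≡ count g
count-cong {zero} f≗g = refl
count-cong {suc n} f≗g = cong₂ _+_ (cong oneIf (f≗g fzero)) (count-cong (f≗g ∘ fsuc))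

count-zero : ∀ {n} {f : Fin n → Bool} → (∀ i → f i ≡ false) → count f ≡ 0
count-zero {zero} f≡false = refl
count-zero {suc n} f≡false = cong₂ _+_ (cong oneIf (f≡false fzero)) (count-zero (f≡false ∘ fsuc))

count-mono : ∀ {n} {f g : Fin n → Bool} → (∀ i → f i ≡ true → g i ≡ true) → count f ≤ count g
count-mono {zero} f⇒g = z≤n
count-mono {suc n} {f} {g} f⇒g =
  ℕₚ.+-mono-≤ (oneIf-mono (f fzero) (g fzero) (f⇒g fzero)) (count-mono (f⇒g ∘ fsuc))
  where
  oneIf-mono : ∀ a b → (a ≡ true → b ≡ true) → oneIf a ≤ oneIf b
  oneIf-mono false b _ = z≤n
  oneIf-mono true b a⇒b rewrite a⇒b refl = ℕₚ.≤-refl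

count-split : ∀ {n} (f g : Fin n → Bool) →
  count f ≡ count (λ i → f i ∧ g i) + count (λ i → f i ∧ not (g i))
count-split {zero} f g = refl
count-split {suc n} f g with f fzero | g fzero
... | false | _ = count-split (f ∘ fsuc) (g ∘ fsuc)
... | true | true = cong suc (count-split (f ∘ fsuc) (g ∘ fsuc))
... | true | false = trans (cong suc (count-split (f ∘ fsuc) (g ∘ fsuc))) (sym (ℕₚ.+-suc _ _))

count-pos : ∀ {n} (f : Fin n → Bool) → 0 < count f → ∃ λ i → f i ≡ true
count-pos {suc n} f pos with f fzero in f0
... | true = fzero , f0
... | false with count-pos (f ∘ fsuc) pos
... | i , fi = fsuc i , fi

infixl 6 _─_

_─_ : ∀ {n} → (Fin n → Bool) → Fin n → Fin n → Bool
(A ─ a) i = if does (i ≟ a) then false else A i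

─-≢ : ∀ {n} (A : Fin n → Bool) {a i : Fin n} → i ≢ a → (A ─ a) i ≡ A i
─-≢ A {a} {i} i≢a with i ≟ a
... | yes i≡a = contradiction i≡a i≢a
... | no _ = refl

─-self : ∀ {n} (A : Fin n → Bool) (a : Fin n) → (A ─ a) a ≡ false
─-self A a with a ≟ a
... | yes _ = refl
... | no a≢a = contradiction refl a≢a

─-true : ∀ {n} (A : Fin n → Bool) {a i : Fin n} → (A ─ a) i ≡ true → i ≢ a × A i ≡ true
─-true A {a} {i} eq with i ≟ a
... | no i≢a = i≢a , eq

count-─ : ∀ {n} (A : Fin n → Bool) (a : Fin n) → count A ≡ oneIf (A a) + count (A ─ a)
count-─ A a = begin
  count A                                    ≡⟨ count≡sum A ⟩
  sum (oneIf ∘ A)                            ≡⟨ ℕΣ.sum-without (oneIf ∘ A) a ⟩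
  oneIf (A a) + sum ((oneIf ∘ A) ℕΣ.without a) ≡⟨ cong (_+_ (oneIf (A a))) (ℕΣ.sum-cong removed) ⟩
  oneIf (A a) + sum (oneIf ∘ (A ─ a))        ≡⟨ cong (_+_ (oneIf (A a))) (count≡sum (A ─ a)) ⟨
  oneIf (A a) + count (A ─ a)                ∎
  where
  open ≡-Reasoning
  removed : ∀ i → ((oneIf ∘ A) ℕΣ.without a) i ≡ oneIf ((A ─ a) i)
  removed i with does (i ≟ a)
  ... | true = refl
  ... | false = refl

count-single : ∀ {n} (A : Fin n → Bool) (a : Fin n) → (∀ i → i ≢ a → A i ≡ false) → count A ≡ oneIf (A a)
count-single A a others = begin
  count A                          ≡⟨ count-─ A a ⟩
  oneIf (A a) + count (A ─ a)      ≡⟨ cong (_+_ (oneIf (A a))) (count-zero none) ⟩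
  oneIf (A a) + 0                  ≡⟨ ℕₚ.+-identityʳ _ ⟩
  oneIf (A a)                      ∎
  where
  open ≡-Reasoning
  none : ∀ i → (A ─ a) i ≡ false
  none i with i ≟ a
  ... | yes _ = refl
  ... | no i≢a = others i i≢a

count-≥2 : ∀ {n} (A : Fin n → Bool) {a b : Fin n} → a ≢ b → A a ≡ true → A b ≡ true → 2 ≤ count A
count-≥2 A a≢b Aa Ab =
  subst₂ _≤_ (cong₂ (λ x y → oneIf x + oneIf y) Aa Ab) (sym (count≡sum A)) (sum-pair≤ (oneIf ∘ A) a≢b)

count≡1-unique : ∀ {n} (A : Fin n → Bool) → count A ≡ 1 → ∀ {a b} → A a ≡ true → A b ≡ true → a ≡ b
count≡1-unique A one {a} {b} Aa Ab with a ≟ b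
... | yes a≡b = a≡b
... | no a≢b = contradiction (subst (2 ≤_) one (count-≥2 A a≢b Aa Ab)) λ { (s≤s ()) }

count-≥2-distinct : ∀ {n} (A : Fin n → Bool) → 2 ≤ count A → ∃₂ λ a b → a ≢ b × A a ≡ true × A b ≡ true
count-≥2-distinct A two with count-pos A (ℕₚ.≤-trans (s≤s z≤n) two)
... | a , Aa with count-pos (A ─ a) (ℕₚ.+-cancelˡ-≤ 1 1 _ (subst (2 ≤_) count-A two))
  where
  count-A : count A ≡ 1 + count (A ─ a)
  count-A = trans (count-─ A a) (cong (λ x → oneIf x + count (A ─ a)) Aa)
... | b , A─ab with ─-true A A─ab
... | b≢a , Ab = a , b , (b≢a ∘ sym) , Aa , Ab

count≤n : ∀ {n} (f : Fin n → Bool) → count f ≤ n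
count≤n {zero} f = z≤n
count≤n {suc n} f with f fzero
... | true = s≤s (count≤n (f ∘ fsuc))
... | false = ℕₚ.m≤n⇒m≤1+n (count≤n (f ∘ fsuc))

-- The handshake lemma

degIn : ∀ {n} → Graph n → (Fin n → Bool) → Fin n → ℕ
degIn G A w = count (λ u → A u ∧ adj G w u)

within : ∀ {n} → (Fin n → Bool) → (Fin n → ℕ) → Fin n → ℕ
within S f u = if S u then f u else 0

signed : Bool → ℕ → ℤ
signed true k = + k
signed false k = - + k

ordered-pair-split : ∀ {n} (E : Fin n → Fin n → Bool) → (∀ u → E u u ≡ false) → ∀ u v →
  oneIf (E u v) ≡ oneIf ((toℕ u <ᵇ toℕ v) ∧ E u v) + oneIf ((toℕ v <ᵇ toℕ u) ∧ E u v)
ordered-pair-split E irr u v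
  with toℕ u <ᵇ toℕ v | ℕₚ.<ᵇ-reflects-< (toℕ u) (toℕ v) | toℕ v <ᵇ toℕ u | ℕₚ.<ᵇ-reflects-< (toℕ v) (toℕ u)
... | true | ofʸ u<v | true | ofʸ v<u = contradiction v<u (ℕₚ.<-asym u<v)
... | true | _ | false | _ = sym (ℕₚ.+-identityʳ _)
... | false | _ | true | _ = refl
... | false | ofⁿ u≮v | false | ofⁿ v≮u with toℕ-injective (ℕₚ.≤-antisym (ℕₚ.≮⇒≥ v≮u) (ℕₚ.≮⇒≥ u≮v))
...   | refl = cong oneIf (irr u)

-- Every unordered pair {u, v} is counted once on the left (as u < v) and twice on the right.
pairs-double : ∀ {n} (E : Fin n → Fin n → Bool) → (∀ u v → E u v ≡ E v u) → (∀ u → E u u ≡ false) →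
  let pairs = sumF (λ u → count (λ v → (toℕ u <ᵇ toℕ v) ∧ E u v)) in
  pairs + pairs ≡ sum (λ u → count (E u))
pairs-double {n} E E-sym E-irr = begin
  pairs + pairs
    ≡⟨ cong₂ _+_ pairs≡P pairs≡P ⟩
  P + P
    ≡⟨ cong (_+_ P) (ℕΣ.sum-cong λ u → ℕΣ.sum-cong λ v → cong (λ b → oneIf (lt u v ∧ b)) (E-sym u v)) ⟩
  P + sum (λ v → sum (λ u → oneIf (lt v u ∧ E u v)))
    ≡⟨ cong (_+_ P) (ℕΣ.∑-comm (λ u v → oneIf (lt v u ∧ E u v))) ⟨
  P + sum (λ u → sum (λ v → oneIf (lt v u ∧ E u v)))
    ≡⟨ ℕΣ.∑-distrib-+ (λ u → sum (λ v → oneIf (lt u v ∧ E u v))) _ ⟨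
  sum (λ u → sum (λ v → oneIf (lt u v ∧ E u v)) + sum (λ v → oneIf (lt v u ∧ E u v)))
    ≡⟨ ℕΣ.sum-cong (λ u → ℕΣ.∑-distrib-+ (λ v → oneIf (lt u v ∧ E u v)) _) ⟨
  sum (λ u → sum (λ v → oneIf (lt u v ∧ E u v) + oneIf (lt v u ∧ E u v)))
    ≡⟨ ℕΣ.sum-cong (λ u → ℕΣ.sum-cong (λ v → ordered-pair-split E E-irr u v)) ⟨
  sum (λ u → sum (λ v → oneIf (E u v)))
    ≡⟨ ℕΣ.sum-cong (λ u → count≡sum (E u)) ⟨
  sum (λ u → count (E u))
    ∎
  where
  open ≡-Reasoning
  lt : Fin n → Fin n → Bool
  lt u v = toℕ u <ᵇ toℕ v
  pairs P : ℕ
  pairs = sumF (λ u → count (λ v → lt u v ∧ E u v))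
  P = sum (λ u → sum (λ v → oneIf (lt u v ∧ E u v)))
  pairs≡P : pairs ≡ P
  pairs≡P = trans (sumF≡sum (λ u → count (λ v → lt u v ∧ E u v)))
                  (ℕΣ.sum-cong (λ u → count≡sum (λ v → lt u v ∧ E u v)))

module _ {n} (G : Graph n) where

  edgesIn-double : ∀ S → edgesIn G S + edgesIn G S ≡ sum (within S (degIn G S))
  edgesIn-double S = trans (pairs-double E E-sym E-irr) (ℕΣ.sum-cong pointwise)
    where
    E : Fin n → Fin n → Bool
    E u v = adj G u v ∧ (S u ∧ S v)
    E-sym : ∀ u v → E u v ≡ E v u
    E-sym u v = cong₂ _∧_ (adj-sym G u v) (∧-comm (S u) (S v))
    E-irr : ∀ u → E u u ≡ false
    E-irr u = cong (_∧ (S u ∧ S u)) (irrefl G u)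
    pointwise : ∀ u → count (E u) ≡ within S (degIn G S) u
    pointwise u with S u
    ... | true = count-cong (λ v → ∧-comm (adj G u v) (S v))
    ... | false = count-zero (λ v → ∧-zeroʳ (adj G u v))

  sum-within-degree : ∀ S B →
    sum (within S (degree G)) ≡ sum (within S (degIn G B)) + sum (within S (degIn G (not ∘ B)))
  sum-within-degree S B = trans (ℕΣ.sum-cong pointwise) (ℕΣ.∑-distrib-+ (within S (degIn G B)) _)
    where
    pointwise : ∀ u → within S (degree G) u ≡ within S (degIn G B) u + within S (degIn G (not ∘ B)) u
    pointwise u with S u
    ... | false = refl
    ... | true = trans (count-split (adj G u) B)
                   (cong₂ _+_ (count-cong λ v → ∧-comm (adj G u v) (B v))
                              (count-cong λ v → ∧-comm (adj G u v) (not (B v))))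

  cut-symmetric : ∀ σ → sum (within σ (degIn G (not ∘ σ))) ≡ sum (within (not ∘ σ) (degIn G σ))
  cut-symmetric σ = begin
    sum (within σ (degIn G (not ∘ σ)))        ≡⟨ ℕΣ.sum-cong from-σ ⟩
    sum (λ u → sum (λ v → cut u v))           ≡⟨ ℕΣ.∑-comm cut ⟩
    sum (λ v → sum (λ u → cut u v))           ≡⟨ ℕΣ.sum-cong to-not-σ ⟨
    sum (within (not ∘ σ) (degIn G σ))        ∎
    where
    open ≡-Reasoning
    cut : Fin n → Fin n → ℕ
    cut u v = oneIf (σ u ∧ not (σ v) ∧ adj G u v)
    from-σ : ∀ u → within σ (degIn G (not ∘ σ)) u ≡ sum (λ v → cut u v)
    from-σ u with σ u
    ... | true = count≡sum (λ v → not (σ v) ∧ adj G u v)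
    ... | false = sym (ℕΣ.sum-zero {n} {f = λ _ → 0} λ _ → refl)
    to-not-σ : ∀ v → within (not ∘ σ) (degIn G σ) v ≡ sum (λ u → cut u v)
    to-not-σ v with σ v
    ... | true = sym (ℕΣ.sum-zero {n} {f = λ u → oneIf (σ u ∧ false)} λ u → cong oneIf (∧-zeroʳ (σ u)))
    ... | false = trans (count≡sum (λ u → σ u ∧ adj G v u))
                        (ℕΣ.sum-cong λ u → cong (λ b → oneIf (σ u ∧ b)) (adj-sym G v u))

  -- The signed degree sum counts every edge inside X twice positively, inside Y twice negatively,
  -- and cut edges once with each sign.
  signed-degree-sum : ∀ σ → ℤΣ.sum (λ u → signed (σ u) (degree G u)) ≡ + 2 * disc G σ
  signed-degree-sum σ = begin
    ℤΣ.sum (λ u → signed (σ u) (degree G u))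
      ≡⟨ ℤΣ.sum-cong split ⟩
    ℤΣ.sum (λ u → + dX u ℤ.+ - + dY u)
      ≡⟨ ℤΣ.∑-distrib-+ (+_ ∘ dX) _ ⟩
    ℤΣ.sum (+_ ∘ dX) ℤ.+ ℤΣ.sum (λ u → - + dY u)
      ≡⟨ cong₂ ℤ._+_ (ℤsum-pos dX) (trans (ℤsum-neg (+_ ∘ dY)) (cong -_ (ℤsum-pos dY))) ⟩
    + sum dX ℤ.- + sum dY
      ≡⟨ cong₂ (λ x y → + x ℤ.- + y) X-side Y-side ⟩
    + (eX + eX + C) ℤ.- + (eY + eY + C)
      ≡⟨ cong₂ ℤ._-_ (pos-+³ eX eX C) (pos-+³ eY eY C) ⟩
    (+ eX ℤ.+ + eX ℤ.+ + C) ℤ.- (+ eY ℤ.+ + eY ℤ.+ + C)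
      ≡⟨ double-difference (+ eX) (+ eY) (+ C) ⟩
    + 2 * disc G σ
      ∎
    where
    open ≡-Reasoning
    dX dY : Fin n → ℕ
    dX = within σ (degree G)
    dY = within (not ∘ σ) (degree G)
    eX eY C : ℕ
    eX = edgesIn G σ
    eY = edgesIn G (not ∘ σ)
    C = sum (within σ (degIn G (not ∘ σ)))
    split : ∀ u → signed (σ u) (degree G u) ≡ + dX u ℤ.+ - + dY u
    split u with σ u
    ... | true = sym (ℤₚ.+-identityʳ _)
    ... | false = sym (ℤₚ.+-identityˡ _)
    X-side : sum dX ≡ eX + eX + C
    X-side = trans (sum-within-degree σ σ) (cong (_+ C) (sym (edgesIn-double σ)))
    Y-side : sum dY ≡ eY + eY + C
    Y-side = trans (sum-within-degree (not ∘ σ) σ)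
      (trans (ℕₚ.+-comm (sum (within (not ∘ σ) (degIn G σ))) _)
             (cong₂ _+_ (sym (edgesIn-double (not ∘ σ))) (sym (cut-symmetric σ))))
    pos-+³ : ∀ a b c → + (a + b + c) ≡ + a ℤ.+ + b ℤ.+ + c
    pos-+³ a b c = trans (ℤₚ.pos-+ (a + b) c) (cong (ℤ._+ + c) (ℤₚ.pos-+ a b))
    double-difference : ∀ a b c → (a ℤ.+ a ℤ.+ c) ℤ.- (b ℤ.+ b ℤ.+ c) ≡ + 2 * (a ℤ.- b)
    double-difference = solve-∀

-- Cycles and walks inside a vertex set

Unique-middle : ∀ {a} {X : Set a} (xs : List X) {y ys} → Unique (xs ++ y ∷ ys) → Unique (y ∷ xs)
Unique-middle [] (_ ∷ _) = [] ∷ []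
Unique-middle (x ∷ xs) (x∉ ∷ u) with Unique-middle xs u
... | y∉xs ∷ uxs = (x≢y ∘ sym ∷ y∉xs) ∷ (Allₚ.++⁻ˡ xs x∉ ∷ uxs)
  where
  x≢y : x ≢ _
  x≢y with Allₚ.++⁻ʳ xs x∉
  ... | x≢y ∷ _ = x≢y

module _ {n} (G : Graph n) where

  flip-adj : ∀ {u v} → adj G u v ≡ true → adj G v u ≡ true
  flip-adj {u} {v} uv = trans (adj-sym G v u) uv

  adj⇒≢ : ∀ {u v} → adj G u v ≡ true → u ≢ v
  adj⇒≢ {u} uv refl with trans (sym uv) (irrefl G u)
  ... | ()

  AdjChain-prefix : ∀ xs {y ys} → AdjChain G (xs ++ y ∷ ys) → AdjChain G (xs ++ y ∷ [])
  AdjChain-prefix [] _ = tt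
  AdjChain-prefix (x ∷ []) (xy , _) = xy , tt
  AdjChain-prefix (x ∷ x′ ∷ xs) (xx′ , chain) = xx′ , AdjChain-prefix (x′ ∷ xs) chain

  module _ (I : Fin n → Bool) (branching : ∀ v → I v ≡ true → 2 ≤ degIn G I v) where
    open import Data.List.Membership.DecPropositional (_≟_ {n}) using (_∈?_)

    private
      previous : Fin n → List (Fin n) → Fin n
      previous h [] = h
      previous h (p ∷ _) = p

      outside : List (Fin n) → Fin n → Bool
      outside path v = not (does (v ∈? path))

      fresh-shrinks : ∀ path {y} → y ∉ path → count (outside (y ∷ path)) < count (outside path)
      fresh-shrinks path {y} y∉path = begin-strict
        count (outside (y ∷ path))              ≤⟨ count-mono shrink ⟩
        count (outside path ─ y)                <⟨ ℕₚ.n<1+n _ ⟩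
        1 + count (outside path ─ y)            ≡⟨ cong (λ b → oneIf b + count (outside path ─ y)) y-outside ⟨
        oneIf (outside path y) + count (outside path ─ y) ≡⟨ count-─ (outside path) y ⟨
        count (outside path)                    ∎
        where
        open ℕₚ.≤-Reasoning
        y-outside : outside path y ≡ true
        y-outside with y ∈? path
        ... | yes y∈ = contradiction y∈ y∉path
        ... | no _ = refl
        shrink : ∀ v → outside (y ∷ path) v ≡ true → (outside path ─ y) v ≡ true
        shrink v out with v ≟ y | v ∈? path
        shrink v () | yes _ | _
        shrink v () | no _ | yes _
        ... | no _ | no _ = refl

      next : ∀ v z → I v ≡ true → ∃ λ y → y ≢ z × I y ≡ true × adj G v y ≡ true
      next v z Iv with count-≥2-distinct (λ u → I u ∧ adj G v u) (branching v Iv)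
      ... | a , b , a≢b , Ia∧va , Ib∧vb with a ≟ z
      ...   | no a≢z = a , a≢z , ∧-true Ia∧va
      ...   | yes refl = b , (a≢b ∘ sym) , ∧-true Ib∧vb

      close : ∀ h rest {y} → Unique (h ∷ rest) → AdjChain G (h ∷ rest) →
        adj G h y ≡ true → y ≢ previous h rest → y ∈ h ∷ rest → HasCycle G
      close h rest {y} uniq chain hy y≢prev y∈ with ∈-∃++ y∈
      ... | [] , _ , refl = contradiction refl (adj⇒≢ hy)
      ... | _ ∷ [] , _ , refl = contradiction refl y≢prev
      ... | a ∷ b ∷ pre , _ , refl =
        y , a , b , pre , Unique-middle (a ∷ b ∷ pre) uniq , flip-adj hy , AdjChain-prefix (a ∷ b ∷ pre) chain

      grow : ∀ k h rest → Unique (h ∷ rest) → AdjChain G (h ∷ rest) → I h ≡ true →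
        count (outside (h ∷ rest)) ≤ k → HasCycle G
      grow k h rest uniq chain Ih bound with next h (previous h rest) Ih
      ... | y , y≢prev , Iy , hy with y ∈? h ∷ rest
      ...   | yes y∈ = close h rest uniq chain hy y≢prev y∈
      ...   | no y∉ with k
      ...     | zero = contradiction (ℕₚ.<-≤-trans (fresh-shrinks (h ∷ rest) y∉) bound) λ ()
      ...     | suc k′ = grow k′ y (h ∷ rest) (Allₚ.¬Any⇒All¬ (h ∷ rest) y∉ ∷ uniq) (flip-adj hy , chain) Iy
                           (ℕₚ.≤-pred (ℕₚ.<-≤-trans (fresh-shrinks (h ∷ rest) y∉) bound))

    -- Walking from x without ever stepping straight back must revisit a vertex, which closes a cycle.
    branching⇒cycle : ∀ {x} → I x ≡ true → HasCycle G
    branching⇒cycle {x} Ix = grow n x [] ([] ∷ []) tt Ix (count≤n (outside (x ∷ [])))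

  acyclic⇒sparse-vertex : ¬ HasCycle G → (I : Fin n → Bool) → ∀ {x} → I x ≡ true →
    ∃ λ v → I v ≡ true × degIn G I v < 2
  acyclic⇒sparse-vertex acyclic I Ix with Finₚ.any? (λ v → (I v Boolₚ.≟ true) ×-dec (degIn G I v ℕₚ.<? 2))
  ... | yes found = found
  ... | no none = contradiction (branching⇒cycle I branching Ix) acyclic
    where
    branching : ∀ v → I v ≡ true → 2 ≤ degIn G I v
    branching v Iv = ℕₚ.≮⇒≥ λ sparse → none (v , Iv , sparse)

  data WalkIn (A : Fin n → Bool) : Fin n → Fin n → Set where
    here : ∀ {v} → WalkIn A v v
    step : ∀ {u w v} → adj G u w ≡ true → A w ≡ true → WalkIn A w v → WalkIn A u v

  ConnectedIn : (Fin n → Bool) → Set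
  ConnectedIn A = ∀ u w → A u ≡ true → A w ≡ true → WalkIn A u w

  degIn-local : ∀ {A B : Fin n → Bool} w → (∀ u → adj G w u ≡ true → A u ≡ B u) → degIn G A w ≡ degIn G B w
  degIn-local {A} {B} w agree = count-cong pointwise
    where
    pointwise : ∀ u → (A u ∧ adj G w u) ≡ (B u ∧ adj G w u)
    pointwise u with adj G w u in wu
    ... | true = cong (_∧ true) (agree u wu)
    ... | false = trans (∧-zeroʳ (A u)) (sym (∧-zeroʳ (B u)))

  leaf-neighbour-unique : ∀ {A l u p} → degIn G A l ≡ 1 →
    A u ≡ true → adj G l u ≡ true → A p ≡ true → adj G l p ≡ true → u ≡ p
  leaf-neighbour-unique {A} {l} leaf Au lu Ap lp =
    count≡1-unique (λ u → A u ∧ adj G l u) leaf (∧-intro Au lu) (∧-intro Ap lp)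

  -- A walk entering a removed leaf must leave it straight back to where it came from.
  walk-skipping-leaves : ∀ {A B : Fin n → Bool} → (∀ z → B z ≡ true → A z ≡ true) →
    (∀ z → A z ≡ true → B z ≡ false → degIn G A z ≡ 1) →
    ∀ {x y} → B x ≡ true → B y ≡ true → WalkIn A x y → WalkIn B x y
  walk-skipping-leaves B⊆A removed-leaf Bx By here = here
  walk-skipping-leaves {A} {B} B⊆A removed-leaf {x} Bx By (step {w = w} xw Aw rest) with B w in Bw
  ... | true = step xw Bw (walk-skipping-leaves B⊆A removed-leaf Bw By rest)
  ... | false with rest
  ...   | here = contradiction (trans (sym By) Bw) λ ()
  ...   | step wq Aq rest′
          with leaf-neighbour-unique (removed-leaf w Aw Bw) Aq wq (B⊆A x Bx) (flip-adj xw)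
  ...     | refl = walk-skipping-leaves B⊆A removed-leaf Bx By rest′

  leaf-edge-component : ∀ {A u w} → adj G u w ≡ true → A u ≡ true → A w ≡ true →
    degIn G A u ≡ 1 → degIn G A w ≡ 1 → ∀ {x y} → WalkIn A x y → x ≡ u ⊎ x ≡ w → y ≡ u ⊎ y ≡ w
  leaf-edge-component uw Au Aw u-leaf w-leaf here x∈ = x∈
  leaf-edge-component uw Au Aw u-leaf w-leaf (step xz Az rest) (inj₁ refl) =
    leaf-edge-component uw Au Aw u-leaf w-leaf rest (inj₂ (leaf-neighbour-unique u-leaf Az xz Aw uw))
  leaf-edge-component uw Au Aw u-leaf w-leaf (step xz Az rest) (inj₂ refl) =
    leaf-edge-component uw Au Aw u-leaf w-leaf rest
      (inj₁ (leaf-neighbour-unique w-leaf Az xz Au (flip-adj uw)))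

-- Cherries

infix 4 _⊑_

_⊑_ : ∀ {n} → Graph n → Graph n → Set
G ⊑ T = ∀ {u w} → adj G u w ≡ true → adj T u w ≡ true

deleteCut⊑ : ∀ {n} (T : Graph n) σ → deleteCut T σ ⊑ T
deleteCut⊑ T σ uw = proj₁ (∧-true uw)

module _ {n} (T : Graph n) where

  degIn-leaf : ∀ {G A l p} → G ⊑ T → degIn T A l ≡ 1 → A p ≡ true → adj T l p ≡ true →
    degIn G A l ≡ oneIf (adj G l p)
  degIn-leaf {G} {A} {l} {p} G⊑T l-leaf Ap lp =
    trans (count-single _ p others) (cong (λ b → oneIf (b ∧ adj G l p)) Ap)
    where
    others : ∀ u → u ≢ p → (A u ∧ adj G l u) ≡ false
    others u u≢p with A u in Au | adj G l u in lu
    ... | false | _ = refl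
    ... | true | false = refl
    ... | true | true = contradiction (leaf-neighbour-unique T l-leaf Au (G⊑T lu) Ap lp) u≢p

  Cubic : (Fin n → Bool) → Set
  Cubic A = ∀ w → A w ≡ true → degIn T A w ≡ 1 ⊎ degIn T A w ≡ 3

  record Cherry (A : Fin n → Bool) : Set where
    field
      v l₁ l₂ : Fin n
      v∈A : A v ≡ true
      l₁∈A : A l₁ ≡ true
      l₂∈A : A l₂ ≡ true
      v-internal : degIn T A v ≡ 3
      l₁-leaf : degIn T A l₁ ≡ 1
      l₂-leaf : degIn T A l₂ ≡ 1
      vl₁ : adj T v l₁ ≡ true
      vl₂ : adj T v l₂ ≡ true
      l₁≢l₂ : l₁ ≢ l₂

  internalIn : (Fin n → Bool) → Fin n → Bool
  internalIn A w = A w ∧ not (degIn T A w ≡ᵇ 1)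

  leafNeighbourIn : (Fin n → Bool) → Fin n → Fin n → Bool
  leafNeighbourIn A v u = (A u ∧ adj T v u) ∧ (degIn T A u ≡ᵇ 1)

  internal⇒3 : ∀ {A} → Cubic A → ∀ {v} → internalIn A v ≡ true → degIn T A v ≡ 3
  internal⇒3 cubic {v} Iv with ∧-true Iv
  ... | Av , not-leaf with cubic v Av
  ...   | inj₂ three = three
  ...   | inj₁ one with trans (sym not-leaf) (cong (λ d → not (d ≡ᵇ 1)) one)
  ...     | ()

  leaf-neighbours≥2 : ∀ {A} → Cubic A → ∀ {v} → internalIn A v ≡ true → degIn T (internalIn A) v < 2 →
    2 ≤ count (leafNeighbourIn A v)
  leaf-neighbours≥2 {A} cubic {v} Iv sparse =
    ℕₚ.+-cancelʳ-≤ 1 2 L (subst (_≤ L + 1) (sym split) (ℕₚ.+-monoʳ-≤ L (ℕₚ.≤-pred sparse)))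
    where
    L = count (leafNeighbourIn A v)
    split : 3 ≡ L + degIn T (internalIn A) v
    split = trans (sym (internal⇒3 cubic Iv))
      (trans (count-split (λ u → A u ∧ adj T v u) (λ u → degIn T A u ≡ᵇ 1))
             (cong (_+_ L) (count-cong λ u → ∧-swapʳ (A u) (adj T v u) _)))

  -- By acyclicity some internal vertex has at most one internal neighbour; two of its three
  -- neighbours are then leaves.
  cherry : ¬ HasCycle T → ∀ {A} → Cubic A → ∀ {x} → A x ≡ true → degIn T A x ≡ 3 → Cherry A
  cherry acyclic {A} cubic {x} Ax x-internal
    with acyclic⇒sparse-vertex T acyclic (internalIn A) (∧-intro Ax (cong (λ d → not (d ≡ᵇ 1)) x-internal))
  ... | v , Iv , sparse with count-≥2-distinct (leafNeighbourIn A v) (leaf-neighbours≥2 cubic Iv sparse)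
  ...   | l₁ , l₂ , l₁≢l₂ , l₁-nbr , l₂-nbr with ∧-true l₁-nbr | ∧-true l₂-nbr
  ...     | l₁-adj , l₁-leaf | l₂-adj , l₂-leaf = record
    { v = v ; l₁ = l₁ ; l₂ = l₂ ; v∈A = proj₁ (∧-true Iv)
    ; l₁∈A = proj₁ (∧-true l₁-adj) ; l₂∈A = proj₁ (∧-true l₂-adj)
    ; v-internal = internal⇒3 cubic Iv ; l₁-leaf = ≡ᵇ-true l₁-leaf ; l₂-leaf = ≡ᵇ-true l₂-leaf
    ; vl₁ = proj₂ (∧-true l₁-adj) ; vl₂ = proj₂ (∧-true l₂-adj) ; l₁≢l₂ = l₁≢l₂ }

  module CherryRemoval {A : Fin n → Bool} (ch : Cherry A) where
    open Cherry ch

    A′ : Fin n → Bool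
    A′ = A ─ l₁ ─ l₂

    v≢l₁ : v ≢ l₁
    v≢l₁ = adj⇒≢ T vl₁

    v≢l₂ : v ≢ l₂
    v≢l₂ = adj⇒≢ T vl₂

    A′-≢ : ∀ {w} → w ≢ l₁ → w ≢ l₂ → A′ w ≡ A w
    A′-≢ w≢l₁ w≢l₂ = trans (─-≢ (A ─ l₁) w≢l₂) (─-≢ A w≢l₁)

    A′⊆A : ∀ w → A′ w ≡ true → A w ≡ true
    A′⊆A w A′w = proj₂ (─-true A (proj₂ (─-true (A ─ l₁) A′w)))

    A′-l₁ : A′ l₁ ≡ false
    A′-l₁ = trans (─-≢ (A ─ l₁) l₁≢l₂) (─-self A l₁)

    A′-l₂ : A′ l₂ ≡ false
    A′-l₂ = ─-self (A ─ l₁) l₂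

    A′⇒≢l₁ : ∀ {w} → A′ w ≡ true → w ≢ l₁
    A′⇒≢l₁ A′w refl with trans (sym A′w) A′-l₁
    ... | ()

    A′⇒≢l₂ : ∀ {w} → A′ w ≡ true → w ≢ l₂
    A′⇒≢l₂ A′w refl with trans (sym A′w) A′-l₂
    ... | ()

    A′-v : A′ v ≡ true
    A′-v = trans (A′-≢ v≢l₁ v≢l₂) v∈A

    removed : ∀ {w} → A w ≡ true → A′ w ≡ false → w ≡ l₁ ⊎ w ≡ l₂
    removed {w} Aw A′w with w ≟ l₁ | w ≟ l₂
    ... | yes w≡l₁ | _ = inj₁ w≡l₁
    ... | no _ | yes w≡l₂ = inj₂ w≡l₂
    ... | no _ | no _ with trans (sym A′w) Aw
    ...   | ()

    only-v-sees-l₁ : ∀ {w} → A w ≡ true → adj T w l₁ ≡ true → w ≡ v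
    only-v-sees-l₁ Aw wl₁ = leaf-neighbour-unique T l₁-leaf Aw (flip-adj T wl₁) v∈A (flip-adj T vl₁)

    only-v-sees-l₂ : ∀ {w} → A w ≡ true → adj T w l₂ ≡ true → w ≡ v
    only-v-sees-l₂ Aw wl₂ = leaf-neighbour-unique T l₂-leaf Aw (flip-adj T wl₂) v∈A (flip-adj T vl₂)

    degIn-away : ∀ {G} → G ⊑ T → ∀ {w} → A w ≡ true → w ≢ v → degIn G A′ w ≡ degIn G A w
    degIn-away {G} G⊑T {w} Aw w≢v = degIn-local G w agree
      where
      agree : ∀ u → adj G w u ≡ true → A′ u ≡ A u
      agree u wu with u ≟ l₁ | u ≟ l₂
      ... | yes refl | _ = contradiction (only-v-sees-l₁ Aw (G⊑T wu)) w≢v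
      ... | no _ | yes refl = contradiction (only-v-sees-l₂ Aw (G⊑T wu)) w≢v
      ... | no _ | no _ = refl

    degIn-centre : ∀ G → degIn G A v ≡ oneIf (adj G v l₁) + (oneIf (adj G v l₂) + degIn G A′ v)
    degIn-centre G = begin
      count nbr
        ≡⟨ count-─ nbr l₁ ⟩
      oneIf (nbr l₁) + count (nbr ─ l₁)
        ≡⟨ cong (_+_ (oneIf (nbr l₁))) (count-─ (nbr ─ l₁) l₂) ⟩
      oneIf (nbr l₁) + (oneIf ((nbr ─ l₁) l₂) + count (nbr ─ l₁ ─ l₂))
        ≡⟨ cong₂ (λ x y → oneIf x + (oneIf y + count (nbr ─ l₁ ─ l₂))) (cong (_∧ _) l₁∈A)
                 (trans (─-≢ nbr (l₁≢l₂ ∘ sym)) (cong (_∧ _) l₂∈A)) ⟩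
      oneIf (adj G v l₁) + (oneIf (adj G v l₂) + count (nbr ─ l₁ ─ l₂))
        ≡⟨ cong (λ c → oneIf (adj G v l₁) + (oneIf (adj G v l₂) + c)) (count-cong commute) ⟩
      oneIf (adj G v l₁) + (oneIf (adj G v l₂) + degIn G A′ v)
        ∎
      where
      open ≡-Reasoning
      nbr : Fin n → Bool
      nbr u = A u ∧ adj G v u
      commute : ∀ u → (nbr ─ l₁ ─ l₂) u ≡ (A′ u ∧ adj G v u)
      commute u with does (u ≟ l₂) | does (u ≟ l₁)
      ... | true | _ = refl
      ... | false | true = refl
      ... | false | false = refl

    count-A : count A ≡ 2 + count A′
    count-A = begin
      count A
        ≡⟨ count-─ A l₁ ⟩
      oneIf (A l₁) + count (A ─ l₁)
        ≡⟨ cong (_+_ (oneIf (A l₁))) (count-─ (A ─ l₁) l₂) ⟩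
      oneIf (A l₁) + (oneIf ((A ─ l₁) l₂) + count A′)
        ≡⟨ cong₂ (λ x y → oneIf x + (oneIf y + count A′)) l₁∈A (trans (─-≢ A (l₁≢l₂ ∘ sym)) l₂∈A) ⟩
      2 + count A′
        ∎
      where open ≡-Reasoning

    v-leaf′ : degIn T A′ v ≡ 1
    v-leaf′ = ℕₚ.+-cancelˡ-≡ 2 _ _ (trans (sym (trans (degIn-centre T) two-edges)) v-internal)
      where
      two-edges : oneIf (adj T v l₁) + (oneIf (adj T v l₂) + degIn T A′ v) ≡ 2 + degIn T A′ v
      two-edges = cong₂ (λ x y → oneIf x + (oneIf y + degIn T A′ v)) vl₁ vl₂

    connected′ : ConnectedIn T A → ConnectedIn T A′
    connected′ connected u w A′u A′w =
      walk-skipping-leaves T A′⊆A leaf A′u A′w (connected u w (A′⊆A u A′u) (A′⊆A w A′w))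
      where
      leaf : ∀ z → A z ≡ true → A′ z ≡ false → degIn T A z ≡ 1
      leaf z Az A′z with removed Az A′z
      ... | inj₁ refl = l₁-leaf
      ... | inj₂ refl = l₂-leaf

-- Profiles of rooted subtrees

-- A profile summarises a 2-colouring of a rooted subtree of T: the colour of the root, a bound on
-- the number of children of the root sharing its colour, a bound on the number of non-root vertices
-- with two same-coloured neighbours, and the phase, the sum of ±(degree in T) over its vertices
-- (+ on colour true).  Twice the discrepancy of a colouring of T is the phase of all of T.
record Profile : Set where
  constructor profile
  field
    colour : Bool
    sameBelow : ℕ
    badBelow : ℕ
    phase : ℤ
open Profile

agree : Bool → Bool → ℕ
agree c c′ = oneIf (c == c′)

bad : ℕ → ℕ → ℕ
bad same other = oneIf (2 ≤ᵇ same + other)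

badAt : Profile → ℕ → ℕ
badAt o other = badBelow o + bad (sameBelow o) other

bad-mono : ∀ {s x s′ x′} → s + x ≤ s′ + x′ → bad s x ≤ bad s′ x′
bad-mono {s} {x} {s′} {x′} le
  with 2 ≤ᵇ s + x | ℕₚ.≤ᵇ-reflects-≤ 2 (s + x) | 2 ≤ᵇ s′ + x′ | ℕₚ.≤ᵇ-reflects-≤ 2 (s′ + x′)
... | false | _ | _ | _ = z≤n
... | true | _ | true | _ = ℕₚ.≤-refl
... | true | ofʸ two | false | ofⁿ not-two = contradiction (ℕₚ.≤-trans two le) not-two

bad-≥2 : ∀ {s x} → 2 ≤ s + x → bad s x ≡ 1
bad-≥2 {s} {x} two with 2 ≤ᵇ s + x | ℕₚ.≤ᵇ-reflects-≤ 2 (s + x)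
... | true | _ = refl
... | false | ofⁿ not-two = contradiction two not-two

vertexProfile : Bool → ℕ → Profile
vertexProfile c d = profile c 0 0 (signed c d)

-- o is realised by a root of colour (colour o) whose two child subtrees realise o₁ and o₂.
Joins : Profile → Profile → Profile → Set
Joins o₁ o₂ o =
  agree (colour o) (colour o₁) + agree (colour o) (colour o₂) ≤ sameBelow o ×
  badAt o₁ (agree (colour o₁) (colour o)) + badAt o₂ (agree (colour o₂) (colour o)) ≤ badBelow o ×
  phase o ≡ phase o₁ ℤ.+ phase o₂ ℤ.+ signed (colour o) 3

Balanced : ℤ → ℤ → Set
Balanced ε x = x ≡ + 0 ⊎ x ≡ + 2 * ε ⊎ x ≡ + 4 * ε

halve-balanced : ∀ {ε d} → Balanced ε (+ 2 * d) → d ≡ + 0 ⊎ d ≡ ε ⊎ d ≡ + 2 * ε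
halve-balanced {ε} {d} (inj₁ none) = inj₁ (ℤₚ.*-cancelˡ-≡ (+ 2) d (+ 0) none)
halve-balanced {ε} {d} (inj₂ (inj₁ once)) = inj₂ (inj₁ (ℤₚ.*-cancelˡ-≡ (+ 2) d ε once))
halve-balanced {ε} {d} (inj₂ (inj₂ twice)) =
  inj₂ (inj₂ (ℤₚ.*-cancelˡ-≡ (+ 2) d (+ 2 * ε) (trans twice (ℤₚ.*-assoc (+ 2) (+ 2) ε))))

-- Two subtrees realising o₁ and o₂, with their roots joined by an edge, form a colouring with at most
-- one bad vertex and phase 0, 2ε or 4ε.
Compatible : ℤ → Profile → Profile → Set
Compatible ε o₁ o₂ =
  badAt o₁ (agree (colour o₁) (colour o₂)) + badAt o₂ (agree (colour o₂) (colour o₁)) ≤ 1 ×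
  Balanced ε (phase o₁ ℤ.+ phase o₂)

Family : Set
Family = List Profile

leafX leafY interior : Family
leafX = vertexProfile true 1 ∷ []
leafY = vertexProfile false 1 ∷ []
interior = vertexProfile true 3 ∷ vertexProfile false 3 ∷ []

-- Families for pruned subtrees containing an internal vertex.  The tables below certify the two
-- properties the pruning needs: joining two subtrees at a new root lands back in the list, and any
-- of these families can be finished off against any family across an edge.
rooted : List Family
rooted =
  (profile false 1 0 (- + 3) ∷ profile true 1 0 (+ 3) ∷ []) ∷
  (profile false 2 0 (- + 5) ∷ profile true 0 0 (+ 1) ∷ []) ∷
  (profile false 0 0 (- + 1) ∷ profile true 2 0 (+ 5) ∷ []) ∷
  (profile false 0 0 (+ 1) ∷ profile false 1 1 (- + 5) ∷ profile true 1 0 (+ 1) ∷ []) ∷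
  (profile false 1 0 (- + 1) ∷ profile true 0 0 (- + 1) ∷ profile true 1 1 (+ 5) ∷ []) ∷
  (profile false 0 0 (+ 3) ∷ profile true 0 0 (- + 3) ∷ []) ∷
  (profile false 0 0 (- + 3) ∷ profile false 0 0 (+ 3) ∷ profile true 1 0 (- + 3) ∷ []) ∷
  (profile false 1 0 (+ 3) ∷ profile true 0 0 (- + 3) ∷ profile true 0 0 (+ 3) ∷ []) ∷
  (profile false 0 0 (- + 5) ∷ profile false 1 0 (+ 1) ∷ profile true 1 0 (+ 7) ∷ profile true 2 0 (+ 1) ∷ []) ∷
  (profile false 1 0 (- + 7) ∷ profile false 2 0 (- + 1) ∷ profile true 0 0 (+ 5) ∷ profile true 1 0 (- + 1) ∷ []) ∷
  (profile false 0 0 (+ 5) ∷ profile false 0 1 (- + 1) ∷ profile false 1 0 (- + 7) ∷ profile true 1 0 (- + 1) ∷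
    profile true 1 0 (+ 5) ∷ []) ∷
  (profile false 1 0 (- + 5) ∷ profile false 1 0 (+ 1) ∷ profile true 0 0 (- + 5) ∷ profile true 0 1 (+ 1) ∷
    profile true 1 0 (+ 7) ∷ []) ∷
  []

families : List Family
families = rooted ++ leafX ∷ leafY ∷ []

joins? : ∀ o₁ o₂ o → Dec (Joins o₁ o₂ o)
joins? o₁ o₂ o = (_ ℕₚ.≤? _) ×-dec (_ ℕₚ.≤? _) ×-dec (_ ℤ.≟ _)

compatible? : ∀ ε o₁ o₂ → Dec (Compatible ε o₁ o₂)
compatible? ε o₁ o₂ = (_ ℕₚ.≤? _) ×-dec ((_ ℤ.≟ _) ⊎-dec (_ ℤ.≟ _) ⊎-dec (_ ℤ.≟ _))

Decomposes : Family → Family → Profile → Set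
Decomposes a b o = Any (λ o₁ → Any (λ o₂ → Joins o₁ o₂ o) b) a

decomposes? : ∀ a b o → Dec (Decomposes a b o)
decomposes? a b o = any? (λ o₁ → any? (λ o₂ → joins? o₁ o₂ o) b) a

Finishes : ℤ → Family → Family → Set
Finishes ε a b = Any (λ o₁ → Any (λ o₂ → Compatible ε o₁ o₂) b) a

finishes? : ∀ ε a b → Dec (Finishes ε a b)
finishes? ε a b = any? (λ o₁ → any? (compatible? ε o₁) b) a

-- Opaque so that the tables are evaluated once, here, and never unfolded where they are used.
opaque
  closure-table : All (λ a → All (λ b → Any (λ m → All (Decomposes a b) m) rooted) families) families
  closure-table = from-yes (all? (λ a → all? (λ b → any? (all? (decomposes? a b)) rooted) families) families)

  finish-table : All (λ a → All (λ b → Finishes (+ 1) a b × Finishes (- + 1) a b) families) rooted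
  finish-table = from-yes (all? (λ a → all? (λ b → finishes? (+ 1) a b ×-dec finishes? (- + 1) a b) families) rooted)

rooted⊆families : ∀ {m} → m ∈ rooted → m ∈ families
rooted⊆families = ∈-++⁺ˡ

leafX∈families : leafX ∈ families
leafX∈families = ∈-++⁺ʳ rooted (here refl)

leafY∈families : leafY ∈ families
leafY∈families = ∈-++⁺ʳ rooted (there (here refl))

vertexProfile∈interior : ∀ c → vertexProfile c 3 ∈ interior
vertexProfile∈interior true = here refl
vertexProfile∈interior false = there (here refl)

join-families : ∀ {a b} → a ∈ families → b ∈ families →
  ∃ λ m → m ∈ rooted × (∀ {o} → o ∈ m → ∃₂ λ o₁ o₂ → o₁ ∈ a × o₂ ∈ b × Joins o₁ o₂ o)
join-families a∈ b∈ with find (All.lookup (All.lookup closure-table a∈) b∈)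
... | m , m∈ , decomposable = m , m∈ , λ o∈ → decompose (All.lookup decomposable o∈)
  where
  decompose : ∀ {a b o} → Decomposes a b o → ∃₂ λ o₁ o₂ → o₁ ∈ a × o₂ ∈ b × Joins o₁ o₂ o
  decompose d with find d
  ... | o₁ , o₁∈ , d₂ with find d₂
  ...   | o₂ , o₂∈ , joins = o₁ , o₂ , o₁∈ , o₂∈ , joins

finish-families : ∀ {ε a b} → ε ≡ + 1 ⊎ ε ≡ - + 1 → a ∈ rooted → b ∈ families →
  ∃₂ λ o₁ o₂ → o₁ ∈ a × o₂ ∈ b × Compatible ε o₁ o₂
finish-families {ε} sign a∈ b∈ with find (pick sign (All.lookup (All.lookup finish-table a∈) b∈))
  where
  pick : ∀ {a b} → ε ≡ + 1 ⊎ ε ≡ - + 1 → Finishes (+ 1) a b × Finishes (- + 1) a b → Finishes ε a b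
  pick (inj₁ refl) = proj₁
  pick (inj₂ refl) = proj₂
... | o₁ , o₁∈ , f with find f
...   | o₂ , o₂∈ , compatible = o₁ , o₂ , o₁∈ , o₂∈ , compatible

infixl 6 _[_]≔_

_[_]≔_ : ∀ {a} {X : Set a} {n} → (Fin n → X) → Fin n → X → Fin n → X
f [ i ]≔ x = updateAt f i (λ _ → x)

[]≔-updates : ∀ {a} {X : Set a} {n} (f : Fin n → X) i {x} → (f [ i ]≔ x) i ≡ x
[]≔-updates f i = updateAt-updates i f

[]≔-minimal : ∀ {a} {X : Set a} {n} (f : Fin n → X) {i j} {x} → j ≢ i → (f [ i ]≔ x) j ≡ f j
[]≔-minimal f {i} {j} j≢i = updateAt-minimal j i f j≢i

-- Colouring by pruning cherries

module _ {n} (T : Graph n) where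

  sameDegIn : (Fin n → Bool) → (Fin n → Profile) → Fin n → ℕ
  sameDegIn A o = degIn (deleteCut T (colour ∘ o)) A

  -- A bound on the number of vertices with two same-coloured neighbours among those that w stands
  -- for: w itself and, when w is a leaf of A, the subtree pruned into it.
  badness : (Fin n → Bool) → (Fin n → Profile) → Fin n → ℕ
  badness A o w = if A w then badAt (o w) (sameDegIn A o w) else 0

  phaseIn : (Fin n → Bool) → (Fin n → Profile) → Fin n → ℤ
  phaseIn A o w = if A w then phase (o w) else + 0

  badness-in : ∀ A o w → A w ≡ true → badness A o w ≡ badAt (o w) (sameDegIn A o w)
  badness-in A o w Aw rewrite Aw = refl

  badness-out : ∀ A o w → A w ≡ false → badness A o w ≡ 0
  badness-out A o w Aw rewrite Aw = refl

  phaseIn-in : ∀ A o w → A w ≡ true → phaseIn A o w ≡ phase (o w)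
  phaseIn-in A o w Aw rewrite Aw = refl

  phaseIn-out : ∀ A o w → A w ≡ false → phaseIn A o w ≡ + 0
  phaseIn-out A o w Aw rewrite Aw = refl

  sameDegIn-recolour : ∀ {A} o o′ {w} → (∀ u → A u ≡ true → colour (o u) ≡ colour (o′ u)) →
    colour (o w) ≡ colour (o′ w) → sameDegIn A o w ≡ sameDegIn A o′ w
  sameDegIn-recolour {A} o o′ {w} same-on-A same-at-w = count-cong pointwise
    where
    pointwise : ∀ u → (A u ∧ adj T w u ∧ (colour (o w) == colour (o u)))
                    ≡ (A u ∧ adj T w u ∧ (colour (o′ w) == colour (o′ u)))
    pointwise u with A u in Au
    ... | false = refl
    ... | true = cong₂ (λ x y → adj T w u ∧ (x == y)) same-at-w (same-on-A u Au)

  sameDegIn-leaf : ∀ {A} o {l p} → degIn T A l ≡ 1 → A p ≡ true → adj T l p ≡ true →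
    sameDegIn A o l ≡ agree (colour (o l)) (colour (o p))
  sameDegIn-leaf {A} o {l} {p} l-leaf Ap lp =
    trans (degIn-leaf T {G = deleteCut T (colour ∘ o)} (deleteCut⊑ T (colour ∘ o)) l-leaf Ap lp)
      (cong (λ b → oneIf (b ∧ (colour (o l) == colour (o p)))) lp)

  -- A is the part of T not yet pruned; each leaf w of A stands for the subtree of T pruned into it,
  -- which can be coloured to realise any profile in the family τ w.
  record Labelled (A : Fin n → Bool) (τ : Fin n → Family) : Set where
    field
      role : ∀ w → A w ≡ true → degIn T A w ≡ 1 × τ w ∈ families ⊎ degIn T A w ≡ 3 × τ w ≡ interior
      connected : ConnectedIn T A
      nontrivial : ∃ λ w → A w ≡ true × (degIn T A w ≡ 3 ⊎ τ w ∈ rooted)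

    cubic : Cubic T A
    cubic w Aw = Sum.map proj₁ proj₁ (role w Aw)

    leaf-family : ∀ {w} → A w ≡ true → degIn T A w ≡ 1 → τ w ∈ families
    leaf-family {w} Aw one with role w Aw
    ... | inj₁ (_ , τw) = τw
    ... | inj₂ (three , _) = contradiction (trans (sym one) three) λ ()

    internal-family : ∀ {w} → A w ≡ true → degIn T A w ≡ 3 → τ w ≡ interior
    internal-family {w} Aw three with role w Aw
    ... | inj₂ (_ , τw) = τw
    ... | inj₁ (one , _) = contradiction (trans (sym one) three) λ ()

  record Solution (A : Fin n → Bool) (τ : Fin n → Family) (ε : ℤ) : Set where
    field
      choice : Fin n → Profile
      fits : ∀ w → A w ≡ true → choice w ∈ τ w
      few-bad : sum (badness A choice) ≤ 1
      balanced : Balanced ε (ℤΣ.sum (phaseIn A choice))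

  solution-on-edge : ∀ {A τ ε w₀ w₁ o₀ o₁} → ConnectedIn T A → (∀ w → A w ≡ true → degIn T A w ≡ 1) →
    A w₀ ≡ true → A w₁ ≡ true → adj T w₀ w₁ ≡ true → o₀ ∈ τ w₀ → o₁ ∈ τ w₁ → Compatible ε o₀ o₁ →
    Solution A τ ε
  solution-on-edge {A} {τ} {ε} {w₀} {w₁} {o₀} {o₁} connected all-leaves Aw₀ Aw₁ w₀w₁ o₀∈ o₁∈ (few , bal) = record
    { choice = o ; fits = fits ; few-bad = few-bad ; balanced = subst (Balanced ε) (sym sum-phase) bal }
    where
    o : Fin n → Profile
    o = (λ _ → o₁) [ w₀ ]≔ o₀
    w₀≢w₁ : w₀ ≢ w₁
    w₀≢w₁ = adj⇒≢ T w₀w₁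
    o-w₀ : o w₀ ≡ o₀
    o-w₀ = []≔-updates _ w₀
    o-w₁ : o w₁ ≡ o₁
    o-w₁ = []≔-minimal _ (w₀≢w₁ ∘ sym)
    on-edge : ∀ {w} → A w ≡ true → w ≡ w₀ ⊎ w ≡ w₁
    on-edge {w} Aw = leaf-edge-component T w₀w₁ Aw₀ Aw₁ (all-leaves w₀ Aw₀) (all-leaves w₁ Aw₁)
                       (connected w₀ w Aw₀ Aw) (inj₁ refl)
    off-edge : ∀ {w} → w ≢ w₀ → w ≢ w₁ → A w ≡ false
    off-edge {w} w≢w₀ w≢w₁ with A w in Aw
    ... | false = refl
    ... | true with on-edge Aw
    ...   | inj₁ w≡w₀ = contradiction w≡w₀ w≢w₀
    ...   | inj₂ w≡w₁ = contradiction w≡w₁ w≢w₁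
    fits : ∀ w → A w ≡ true → o w ∈ τ w
    fits w Aw with on-edge Aw
    ... | inj₁ refl = subst (_∈ τ w₀) (sym o-w₀) o₀∈
    ... | inj₂ refl = subst (_∈ τ w₁) (sym o-w₁) o₁∈
    same-w₀ : sameDegIn A o w₀ ≡ agree (colour o₀) (colour o₁)
    same-w₀ = trans (sameDegIn-leaf o (all-leaves w₀ Aw₀) Aw₁ w₀w₁)
                    (cong₂ (λ x y → agree (colour x) (colour y)) o-w₀ o-w₁)
    same-w₁ : sameDegIn A o w₁ ≡ agree (colour o₁) (colour o₀)
    same-w₁ = trans (sameDegIn-leaf o (all-leaves w₁ Aw₁) Aw₀ (flip-adj T w₀w₁))
                    (cong₂ (λ x y → agree (colour x) (colour y)) o-w₁ o-w₀)
    few-bad : sum (badness A o) ≤ 1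
    few-bad = begin
      sum (badness A o)
        ≡⟨ ℕΣ.sum-pair w₀≢w₁ (λ w w≢w₀ w≢w₁ → badness-out A o w (off-edge w≢w₀ w≢w₁)) ⟩
      badness A o w₀ + badness A o w₁
        ≡⟨ cong₂ _+_ (badness-in A o w₀ Aw₀) (badness-in A o w₁ Aw₁) ⟩
      badAt (o w₀) (sameDegIn A o w₀) + badAt (o w₁) (sameDegIn A o w₁)
        ≡⟨ cong₂ _+_ (cong₂ badAt o-w₀ same-w₀) (cong₂ badAt o-w₁ same-w₁) ⟩
      badAt o₀ (agree (colour o₀) (colour o₁)) + badAt o₁ (agree (colour o₁) (colour o₀))
        ≤⟨ few ⟩
      1 ∎
      where open ℕₚ.≤-Reasoning
    sum-phase : ℤΣ.sum (phaseIn A o) ≡ phase o₀ ℤ.+ phase o₁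
    sum-phase = trans (ℤΣ.sum-pair w₀≢w₁ (λ w w≢w₀ w≢w₁ → phaseIn-out A o w (off-edge w≢w₀ w≢w₁)))
      (cong₂ ℤ._+_ (trans (phaseIn-in A o w₀ Aw₀) (cong phase o-w₀))
                   (trans (phaseIn-in A o w₁ Aw₁) (cong phase o-w₁)))

  edge-solution : ∀ {A τ ε} → Labelled A τ → ε ≡ + 1 ⊎ ε ≡ - + 1 →
    (∀ w → A w ≡ true → degIn T A w ≡ 1) → Solution A τ ε
  edge-solution {A} lab sign all-leaves with Labelled.nontrivial lab
  ... | w₀ , Aw₀ , inj₁ three = contradiction (trans (sym (all-leaves w₀ Aw₀)) three) λ ()
  ... | w₀ , Aw₀ , inj₂ τw₀
    with count-pos (λ u → A u ∧ adj T w₀ u) (subst (0 <_) (sym (all-leaves w₀ Aw₀)) (s≤s z≤n))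
  ...   | w₁ , nbr with ∧-true nbr
  ...     | Aw₁ , w₀w₁ with finish-families sign τw₀ (Labelled.leaf-family lab Aw₁ (all-leaves w₁ Aw₁))
  ...       | o₀ , o₁ , o₀∈ , o₁∈ , compatible =
    solution-on-edge (Labelled.connected lab) all-leaves Aw₀ Aw₁ w₀w₁ o₀∈ o₁∈ compatible

  module Pruning {A τ} (lab : Labelled A τ) (ch : Cherry T A) where
    open Labelled lab
    open Cherry ch
    open CherryRemoval T ch

    private
      joined = join-families (leaf-family l₁∈A l₁-leaf) (leaf-family l₂∈A l₂-leaf)

    m : Family
    m = proj₁ joined

    τ′ : Fin n → Family
    τ′ = τ [ v ]≔ m

    labelled′ : Labelled A′ τ′
    labelled′ = record
      { role = role′
      ; connected = connected′ connected
      ; nontrivial = v , A′-v , inj₂ (subst (_∈ rooted) (sym ([]≔-updates τ v)) (proj₁ (proj₂ joined)))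
      }
      where
      role′ : ∀ w → A′ w ≡ true → degIn T A′ w ≡ 1 × τ′ w ∈ families ⊎ degIn T A′ w ≡ 3 × τ′ w ≡ interior
      role′ w A′w with w ≟ v
      ... | yes refl =
        inj₁ (v-leaf′ , subst (_∈ families) (sym ([]≔-updates τ v)) (rooted⊆families (proj₁ (proj₂ joined))))
      ... | no w≢v rewrite degIn-away {T} (λ e → e) (A′⊆A w A′w) w≢v | []≔-minimal τ {x = m} w≢v =
        role w (A′⊆A w A′w)

    decompose : ∀ {o} → o ∈ τ′ v → ∃₂ λ o₁ o₂ → o₁ ∈ τ l₁ × o₂ ∈ τ l₂ × Joins o₁ o₂ o
    decompose o∈ = proj₂ (proj₂ joined) (subst (_ ∈_) ([]≔-updates τ v) o∈)

    module Lift {ε} (sol′ : Solution A′ τ′ ε) {o₁ o₂ : Profile} (o₁∈ : o₁ ∈ τ l₁) (o₂∈ : o₂ ∈ τ l₂)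
                (joins : Joins o₁ o₂ (Solution.choice sol′ v)) where
      open Solution sol′ renaming (choice to o′; fits to fits′; few-bad to few-bad′; balanced to balanced′)

      c : Bool
      c = colour (o′ v)

      o : Fin n → Profile
      o = o′ [ v ]≔ vertexProfile c 3 [ l₁ ]≔ o₁ [ l₂ ]≔ o₂

      β β′ : Fin n → ℕ
      β = badness A o
      β′ = badness A′ o′

      φ φ′ : Fin n → ℤ
      φ = phaseIn A o
      φ′ = phaseIn A′ o′

      o-l₂ : o l₂ ≡ o₂
      o-l₂ = []≔-updates _ l₂

      o-l₁ : o l₁ ≡ o₁
      o-l₁ = trans ([]≔-minimal _ l₁≢l₂) ([]≔-updates _ l₁)

      o-v : o v ≡ vertexProfile c 3
      o-v = trans ([]≔-minimal _ v≢l₂) (trans ([]≔-minimal _ v≢l₁) ([]≔-updates o′ v))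

      o-away : ∀ {w} → w ≢ v → w ≢ l₁ → w ≢ l₂ → o w ≡ o′ w
      o-away w≢v w≢l₁ w≢l₂ = trans ([]≔-minimal _ w≢l₂) (trans ([]≔-minimal _ w≢l₁) ([]≔-minimal o′ w≢v))

      recoloured : ∀ {w} → w ≢ l₁ → w ≢ l₂ → colour (o w) ≡ colour (o′ w)
      recoloured {w} w≢l₁ w≢l₂ with w ≟ v
      ... | yes refl = cong colour o-v
      ... | no w≢v = cong colour (o-away w≢v w≢l₁ w≢l₂)

      same-A′ : ∀ {w} → w ≢ l₁ → w ≢ l₂ → degIn (deleteCut T (colour ∘ o)) A′ w ≡ sameDegIn A′ o′ w
      same-A′ w≢l₁ w≢l₂ =
        sameDegIn-recolour o o′ (λ u A′u → recoloured (A′⇒≢l₁ A′u) (A′⇒≢l₂ A′u)) (recoloured w≢l₁ w≢l₂)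

      same-away : ∀ {w} → A w ≡ true → w ≢ v → w ≢ l₁ → w ≢ l₂ → sameDegIn A o w ≡ sameDegIn A′ o′ w
      same-away Aw w≢v w≢l₁ w≢l₂ =
        trans (sym (degIn-away {deleteCut T (colour ∘ o)} (deleteCut⊑ T (colour ∘ o)) Aw w≢v))
              (same-A′ w≢l₁ w≢l₂)

      same-v : sameDegIn A o v ≡ agree c (colour o₁) + (agree c (colour o₂) + sameDegIn A′ o′ v)
      same-v = begin
        sameDegIn A o v
          ≡⟨ degIn-centre G ⟩
        oneIf (adj G v l₁) + (oneIf (adj G v l₂) + degIn G A′ v)
          ≡⟨ cong₂ (λ x y → x + (y + degIn G A′ v)) (towards vl₁ o-l₁) (towards vl₂ o-l₂) ⟩
        agree c (colour o₁) + (agree c (colour o₂) + degIn G A′ v)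
          ≡⟨ cong (λ x → agree c (colour o₁) + (agree c (colour o₂) + x)) (same-A′ v≢l₁ v≢l₂) ⟩
        agree c (colour o₁) + (agree c (colour o₂) + sameDegIn A′ o′ v)
          ∎
        where
        open ≡-Reasoning
        G = deleteCut T (colour ∘ o)
        towards : ∀ {l oₗ} → adj T v l ≡ true → o l ≡ oₗ → oneIf (adj G v l) ≡ agree c (colour oₗ)
        towards {l} vl refl = cong₂ (λ x p → oneIf (x ∧ (colour p == colour (o l)))) vl o-v

      same-l₁ : sameDegIn A o l₁ ≡ agree (colour o₁) c
      same-l₁ = trans (sameDegIn-leaf o l₁-leaf v∈A (flip-adj T vl₁))
                      (cong₂ (λ x y → agree (colour x) (colour y)) o-l₁ o-v)

      same-l₂ : sameDegIn A o l₂ ≡ agree (colour o₂) c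
      same-l₂ = trans (sameDegIn-leaf o l₂-leaf v∈A (flip-adj T vl₂))
                      (cong₂ (λ x y → agree (colour x) (colour y)) o-l₂ o-v)

      badness-away : ∀ w → w ≢ v → w ≢ l₁ → w ≢ l₂ → β w ≡ β′ w
      badness-away w w≢v w≢l₁ w≢l₂ with true-or-false (A w)
      ... | inj₁ Aw = trans (badness-in A o w Aw)
                        (trans (cong₂ badAt (o-away w≢v w≢l₁ w≢l₂) (same-away Aw w≢v w≢l₁ w≢l₂))
                               (sym (badness-in A′ o′ w (trans (A′-≢ w≢l₁ w≢l₂) Aw))))
      ... | inj₂ Aw = trans (badness-out A o w Aw) (sym (badness-out A′ o′ w (trans (A′-≢ w≢l₁ w≢l₂) Aw)))

      phase-away : ∀ w → w ≢ v → w ≢ l₁ → w ≢ l₂ → φ w ≡ φ′ w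
      phase-away w w≢v w≢l₁ w≢l₂ with true-or-false (A w)
      ... | inj₁ Aw = trans (phaseIn-in A o w Aw)
                        (trans (cong phase (o-away w≢v w≢l₁ w≢l₂))
                               (sym (phaseIn-in A′ o′ w (trans (A′-≢ w≢l₁ w≢l₂) Aw))))
      ... | inj₂ Aw = trans (phaseIn-out A o w Aw) (sym (phaseIn-out A′ o′ w (trans (A′-≢ w≢l₁ w≢l₂) Aw)))

      -- In A′ the leaf v carries the joined profile o′ v, whose sameBelow bounds the same-coloured
      -- children of v and whose badBelow bounds the bad vertices strictly below v.
      badness-cherry : β v + (β l₁ + β l₂) ≤ β′ v + (β′ l₁ + β′ l₂)
      badness-cherry = begin
        β v + (β l₁ + β l₂)
          ≡⟨ cong₂ _+_ (badness-in A o v v∈A) (cong₂ _+_ (badness-in A o l₁ l₁∈A) (badness-in A o l₂ l₂∈A)) ⟩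
        badAt (o v) (sameDegIn A o v) + (badAt (o l₁) (sameDegIn A o l₁) + badAt (o l₂) (sameDegIn A o l₂))
          ≡⟨ cong₂ _+_ (cong₂ badAt o-v same-v) (cong₂ _+_ (cong₂ badAt o-l₁ same-l₁) (cong₂ badAt o-l₂ same-l₂)) ⟩
        bad 0 (agree c (colour o₁) + (agree c (colour o₂) + s′))
          + (badAt o₁ (agree (colour o₁) c) + badAt o₂ (agree (colour o₂) c))
          ≤⟨ ℕₚ.+-mono-≤ (bad-mono {0} {s′ = sameBelow (o′ v)} {x′ = s′} same-bound) (proj₁ (proj₂ joins)) ⟩
        bad (sameBelow (o′ v)) s′ + badBelow (o′ v)
          ≡⟨ ℕₚ.+-comm _ (badBelow (o′ v)) ⟩
        badAt (o′ v) s′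
          ≡⟨ ℕₚ.+-identityʳ _ ⟨
        badAt (o′ v) s′ + 0
          ≡⟨ cong₂ _+_ (badness-in A′ o′ v A′-v) (cong₂ _+_ (badness-out A′ o′ l₁ A′-l₁) (badness-out A′ o′ l₂ A′-l₂)) ⟨
        β′ v + (β′ l₁ + β′ l₂) ∎
        where
        open ℕₚ.≤-Reasoning
        s′ = sameDegIn A′ o′ v
        same-bound : agree c (colour o₁) + (agree c (colour o₂) + s′) ≤ sameBelow (o′ v) + s′
        same-bound = ℕₚ.≤-trans (ℕₚ.≤-reflexive (sym (ℕₚ.+-assoc (agree c (colour o₁)) _ s′)))
                                (ℕₚ.+-monoˡ-≤ s′ (proj₁ joins))

      phase-cherry : φ v ℤ.+ (φ l₁ ℤ.+ φ l₂) ≡ φ′ v ℤ.+ (φ′ l₁ ℤ.+ φ′ l₂)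
      phase-cherry = begin
        φ v ℤ.+ (φ l₁ ℤ.+ φ l₂)
          ≡⟨ cong₂ ℤ._+_ (trans (phaseIn-in A o v v∈A) (cong phase o-v))
                         (cong₂ ℤ._+_ (trans (phaseIn-in A o l₁ l₁∈A) (cong phase o-l₁))
                                      (trans (phaseIn-in A o l₂ l₂∈A) (cong phase o-l₂))) ⟩
        signed c 3 ℤ.+ (phase o₁ ℤ.+ phase o₂)
          ≡⟨ ℤₚ.+-comm (signed c 3) _ ⟩
        phase o₁ ℤ.+ phase o₂ ℤ.+ signed c 3
          ≡⟨ proj₂ (proj₂ joins) ⟨
        phase (o′ v)
          ≡⟨ ℤₚ.+-identityʳ _ ⟨
        phase (o′ v) ℤ.+ + 0
          ≡⟨ cong₂ ℤ._+_ (phaseIn-in A′ o′ v A′-v) (cong₂ ℤ._+_ (phaseIn-out A′ o′ l₁ A′-l₁) (phaseIn-out A′ o′ l₂ A′-l₂)) ⟨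
        φ′ v ℤ.+ (φ′ l₁ ℤ.+ φ′ l₂) ∎
        where open ≡-Reasoning

      fits : ∀ w → A w ≡ true → o w ∈ τ w
      fits w Aw with w ≟ l₁ | w ≟ l₂ | w ≟ v
      ... | yes refl | _ | _ = subst (_∈ τ l₁) (sym o-l₁) o₁∈
      ... | no _ | yes refl | _ = subst (_∈ τ l₂) (sym o-l₂) o₂∈
      ... | no _ | no _ | yes refl =
        subst₂ _∈_ (sym o-v) (sym (internal-family v∈A v-internal)) (vertexProfile∈interior c)
      ... | no w≢l₁ | no w≢l₂ | no w≢v =
        subst₂ _∈_ (sym (o-away w≢v w≢l₁ w≢l₂)) ([]≔-minimal τ w≢v) (fits′ w (trans (A′-≢ w≢l₁ w≢l₂) Aw))

      solution : Solution A τ ε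
      solution = record
        { choice = o
        ; fits = fits
        ; few-bad = ℕₚ.≤-trans sum-badness few-bad′
        ; balanced = subst (Balanced ε) (sym sum-phase) balanced′
        }
        where
        sum-badness : sum β ≤ sum β′
        sum-badness with ℕΣ.sum-local₃ β β′ v≢l₁ v≢l₂ l₁≢l₂ badness-away
        ... | S , split , split′ = ℕₚ.≤-trans (ℕₚ.≤-reflexive split)
                                     (ℕₚ.≤-trans (ℕₚ.+-monoˡ-≤ S badness-cherry) (ℕₚ.≤-reflexive (sym split′)))
        sum-phase : ℤΣ.sum φ ≡ ℤΣ.sum φ′
        sum-phase with ℤΣ.sum-local₃ φ φ′ v≢l₁ v≢l₂ l₁≢l₂ phase-away
        ... | S , split , split′ = trans split (trans (cong (ℤ._+ S) phase-cherry) (sym split′))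

    lift : ∀ {ε} → Solution A′ τ′ ε → Solution A τ ε
    lift sol′ with decompose (Solution.fits sol′ v A′-v)
    ... | o₁ , o₂ , o₁∈ , o₂∈ , joins = Lift.solution sol′ o₁∈ o₂∈ joins

  solve : ¬ HasCycle T → ∀ k {A τ ε} → count A < k → Labelled A τ → ε ≡ + 1 ⊎ ε ≡ - + 1 → Solution A τ ε
  solve acyclic (suc k) {A} bound lab sign
    with Finₚ.any? (λ w → (A w Boolₚ.≟ true) ×-dec (degIn T A w ℕₚ.≟ 3))
  ... | yes (x , Ax , x-internal) =
    Pruning.lift lab ch (solve acyclic k bound′ (Pruning.labelled′ lab ch) sign)
    where
    ch = cherry T acyclic (Labelled.cubic lab) Ax x-internal
    bound′ : count (CherryRemoval.A′ T ch) < k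
    bound′ = ℕₚ.≤-pred (ℕₚ.≤-trans (s≤s (ℕₚ.n≤1+n _))
                                   (subst (_< suc k) (CherryRemoval.count-A T ch) bound))
  ... | no no-internal = edge-solution lab sign all-leaves
    where
    all-leaves : ∀ w → A w ≡ true → degIn T A w ≡ 1
    all-leaves w Aw with Labelled.cubic lab w Aw
    ... | inj₁ one = one
    ... | inj₂ three = contradiction (w , Aw , three) no-internal

everything : ∀ {n} → Fin n → Bool
everything _ = true

module _ {n} (T : Graph n) where

  walk⇒walkIn : ∀ {u w} → Walk T u w → WalkIn T everything u w
  walk⇒walkIn here = here
  walk⇒walkIn (step uw rest) = step uw refl (walk⇒walkIn rest)

  all-leaves-edge : Connected T → (∀ w → degree T w ≡ 1) →
    ∀ {u p} → adj T u p ≡ true → ∀ x → x ≢ u → x ≡ p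
  all-leaves-edge connected leaf {u} {p} up x x≢u
    with leaf-edge-component T up refl refl (leaf u) (leaf p) (walk⇒walkIn (connected u x)) (inj₁ refl)
  ... | inj₁ x≡u = contradiction x≡u x≢u
  ... | inj₂ x≡p = x≡p

  all-leaves⇒n<3 : Connected T → (∀ w → degree T w ≡ 1) → ¬ 3 ≤ n
  all-leaves⇒n<3 connected leaf (s≤s (s≤s (s≤s _)))
    with count-pos (adj T fzero) (subst (0 <_) (sym (leaf fzero)) (s≤s z≤n))
  ... | p , 0p with all-leaves-edge connected leaf 0p (fsuc fzero) (λ ())
                  | all-leaves-edge connected leaf 0p (fsuc (fsuc fzero)) (λ ())
  ...   | refl | ()

  internal-vertex : Connected T → 3 ≤ n → (∀ w → degree T w ≡ 1 ⊎ degree T w ≡ 3) →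
    ∃ λ w → degree T w ≡ 3
  internal-vertex connected three degrees with Finₚ.any? (λ w → degree T w ℕₚ.≟ 3)
  ... | yes found = found
  ... | no none = contradiction three (all-leaves⇒n<3 connected leaf)
    where
    leaf : ∀ w → degree T w ≡ 1
    leaf w with degrees w
    ... | inj₁ one = one
    ... | inj₂ three = contradiction (w , three) none

  initialFamily : (Fin n → Bool) → Fin n → Family
  initialFamily X w = if degree T w ≡ᵇ 1 then (if X w then leafX else leafY) else interior

  module _ (X : Fin n → Bool) where

    initial-labelled : IsCubicTree T → 3 ≤ n → Labelled T everything (initialFamily X)
    initial-labelled ((connected , _) , degrees) three = record
      { role = λ w _ → role w
      ; connected = λ u w _ _ → walk⇒walkIn (connected u w)
      ; nontrivial = map₂ (λ d → refl , inj₁ d) (internal-vertex connected three degrees)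
      }
      where
      role : ∀ w → degree T w ≡ 1 × initialFamily X w ∈ families
                 ⊎ degree T w ≡ 3 × initialFamily X w ≡ interior
      role w with degrees w
      ... | inj₂ three rewrite three = inj₂ (refl , refl)
      ... | inj₁ one rewrite one with X w
      ...   | true = inj₁ (refl , leafX∈families)
      ...   | false = inj₁ (refl , leafY∈families)

    leaf-colour : ∀ {o w} → o ∈ initialFamily X w → degree T w ≡ 1 → colour o ≡ X w
    leaf-colour {w = w} o∈ one rewrite one with X w
    leaf-colour (here refl) one | true = refl
    leaf-colour (here refl) one | false = refl

    initial-phase : ∀ {o w} → o ∈ initialFamily X w → degree T w ≡ 1 ⊎ degree T w ≡ 3 →
      phase o ≡ signed (colour o) (degree T w)
    initial-phase {w = w} o∈ (inj₁ one) rewrite one with X w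
    initial-phase (here refl) (inj₁ one) | true = refl
    initial-phase (here refl) (inj₁ one) | false = refl
    initial-phase {w = w} o∈ (inj₂ three) rewrite three with o∈
    ... | here refl = refl
    ... | there (here refl) = refl

    module FromSolution (degrees : ∀ w → degree T w ≡ 1 ⊎ degree T w ≡ 3) {ε}
                        (sol : Solution T everything (initialFamily X) ε) where
      open Solution sol

      colouring : Fin n → Bool
      colouring = colour ∘ choice

      colouring-leaf : ∀ w → degree T w ≡ 1 → colouring w ≡ X w
      colouring-leaf w = leaf-colour (fits w refl)

      disc-allowed : disc T colouring ≡ + 0 ⊎ disc T colouring ≡ ε ⊎ disc T colouring ≡ + 2 * ε
      disc-allowed = halve-balanced (subst (Balanced ε) phase≡2disc balanced)
        where
        phase≡2disc : ℤΣ.sum (phaseIn T everything choice) ≡ + 2 * disc T colouring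
        phase≡2disc = trans (ℤΣ.sum-cong λ w → initial-phase (fits w refl) (degrees w))
                            (signed-degree-sum T colouring)

      bad-vertex : ∀ u → degree (deleteCut T colouring) u > 1 → 1 ≤ badness T everything choice u
      bad-vertex u two = begin
        1                               ≡⟨ bad-≥2 {0} two ⟨
        bad 0 d                         ≤⟨ bad-mono {0} {d} {sameBelow (choice u)} {d} (ℕₚ.+-monoˡ-≤ d z≤n) ⟩
        bad (sameBelow (choice u)) d    ≤⟨ ℕₚ.m≤n+m _ (badBelow (choice u)) ⟩
        badness T everything choice u   ∎
        where
        open ℕₚ.≤-Reasoning
        d = degree (deleteCut T colouring) u

      at-most-one-bad : ∀ u v → degree (deleteCut T colouring) u > 1 → degree (deleteCut T colouring) v > 1 →
        u ≡ v
      at-most-one-bad u v u-bad v-bad with u ≟ v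
      ... | yes u≡v = u≡v
      ... | no u≢v = contradiction two-bad λ { (s≤s ()) }
        where
        two-bad : 2 ≤ 1
        two-bad = ℕₚ.≤-trans (ℕₚ.+-mono-≤ (bad-vertex u u-bad) (bad-vertex v v-bad))
                             (ℕₚ.≤-trans (sum-pair≤ (badness T everything choice) u≢v) few-bad)

lemma2p3 : ∀ {n : ℕ} (T : Graph n) → IsCubicTree T → n ≥ 4 →
    (X Y : Fin n → Bool) → IsSplitOfLeaves T X Y →
    (ε : ℤ) → (ε ≡ + 1 ⊎ ε ≡ - (+ 1)) →
    Σ (Fin n → Bool) λ s →
      ((∀ v → X v ≡ true → sideX s v ≡ true) × (∀ v → Y v ≡ true → sideY s v ≡ true)) ×
      (disc T s ≡ + 0 ⊎ disc T s ≡ ε ⊎ disc T s ≡ + 2 * ε) ×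
      (∀ u v → degree (deleteCut T s) u > 1 → degree (deleteCut T s) v > 1 → u ≡ v)
lemma2p3 {n} T cubic-tree@((_ , acyclic) , degrees) n≥4 X Y (disjoint , split⇒leaf , _) ε sign =
  colouring , (X-side , Y-side) , disc-allowed , at-most-one-bad
  where
  start : Labelled T everything (initialFamily T X)
  start = initial-labelled T X cubic-tree (ℕₚ.≤-trans (ℕₚ.n≤1+n 3) n≥4)
  open FromSolution T X degrees (solve T acyclic (suc n) (s≤s (count≤n everything)) start sign)
  X-side : ∀ v → X v ≡ true → colouring v ≡ true
  X-side v Xv = trans (colouring-leaf v (split⇒leaf v (inj₁ Xv))) Xv
  Y-side : ∀ v → Y v ≡ true → not (colouring v) ≡ true
  Y-side v Yv = cong not (trans (colouring-leaf v (split⇒leaf v (inj₂ Yv))) (Boolₚ.¬-not λ Xv → disjoint v (Xv , Yv)))
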